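{- Let $E$ be a finite ground set and let $X \subseteq \{0,1\}^E$ be non-empty. If $S \subseteq E$ is identifying for $X$, then $S$ is controlling for $(X,\mathcal{C})$, where $\mathcal{C}$ is the class of all functions $c\colon X \to \mathbb{R}$.
   Context: A set $S \subseteq E$ is controlling for $(X,\mathcal{C})$ if for every $c \in \mathcal{C}$ and every $x^* \in X$ there is $\gamma \in \mathbb{R}^S$ such that the minimum $\min_{x \in X}\{c(x) + \sum_{e\in S}\gamma_e x_e\}$ exists and is attained at $x^*$. A set $S \subseteq E$ is identifying for $X$ if for all $x, x' \in X$ with $x \neq x'$ there is $e \in S$ with $x_e \neq x'_e$. -}

module Defs where

open import Level using (Level; _⊔_) renaming (suc to lsuc)
open import Data.Nat using (ℕ; zero; suc)
open import Data.Bool using (Bool; true; false; T; if_then_else_; _∧_)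
open import Data.Fin using (Fin; zero; suc)
open import Data.Fin.Subset using (Subset; _∈_)
open import Data.Vec using (Vec; lookup)
open import Data.Product using (Σ; ∃; _×_; _,_)
open import Relation.Nullary using (¬_)
open import Relation.Binary.PropositionalEquality using (_≡_; _≢_)
open import Relation.Binary.Structures using (IsTotalOrder)
open import Algebra.Bundles using (CommutativeRing)

-- An ordered field (the real numbers ℝ are an instance).
record OrderedField (c ℓ₁ ℓ₂ : Level) : Set (lsuc (c ⊔ ℓ₁ ⊔ ℓ₂)) where
  field
    commutativeRing : CommutativeRing c ℓ₁
  open CommutativeRing commutativeRing public
  field
    _≤_          : Carrier → Carrier → Set ℓ₂
    isTotalOrder : IsTotalOrder _≈_ _≤_
    +-monoˡ-≤    : ∀ {a b} d → a ≤ b → (a + d) ≤ (b + d)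
    *-nonneg     : ∀ {a b} → 0# ≤ a → 0# ≤ b → 0# ≤ (a * b)
    0≉1          : ¬ (0# ≈ 1#)
    inverse      : ∀ a → ¬ (a ≈ 0#) → ∃ λ b → (a * b) ≈ 1#

module _ {c ℓ₁ ℓ₂ : Level} (F : OrderedField c ℓ₁ ℓ₂) where
  open OrderedField F using (Carrier; 0#; _+_; _≤_)

  ∑ : ∀ {n} → (Fin n → Carrier) → Carrier
  ∑ {zero}  f = 0#
  ∑ {suc n} f = f zero + ∑ (λ e → f (suc e))

  -- Σ_{e ∈ S} γ_e x_e  (γ values outside S are ignored; x_e ∈ {0,1})
  penalty : ∀ {n} → Subset n → (Fin n → Carrier) → Vec Bool n → Carrier
  penalty S γ x = ∑ (λ e → if lookup S e ∧ lookup x e then γ e else 0#)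

  -- S ⊆ E = Fin n is controlling for (X, 𝒞) where 𝒞 = all functions X → F
  -- (X ⊆ {0,1}^E given by its Boolean membership predicate).
  ControllingAll : ∀ {n} → (Vec Bool n → Bool) → Subset n → Set (c ⊔ ℓ₂)
  ControllingAll {n} X S =
    (cost : (x : Vec Bool n) → T (X x) → Carrier) →
    (x* : Vec Bool n) (px* : T (X x*)) →
    ∃ λ (γ : Fin n → Carrier) →
      ∀ (x : Vec Bool n) (px : T (X x)) →
        (cost x* px* + penalty S γ x*) ≤ (cost x px + penalty S γ x)

Identifying : ∀ {n} → (Vec Bool n → Bool) → Subset n → Set
Identifying {n} X S =
  ∀ (x x′ : Vec Bool n) → T (X x) → T (X x′) → x ≢ x′ →
    ∃ λ e → e ∈ S × lookup x e ≢ lookup x′ e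

{-# OPTIONS --safe #-}
module Submission where

-- Let m ≥ 0 bound c(x*) − c(x) over the finite set X, and give every e ∈ S the weight
-- γ_e = −m if x*_e = 1 and γ_e = m otherwise. Then the penalty of x exceeds that of x*
-- by m times the number of coordinates in S where x and x* differ. If S is identifying,
-- every x ≠ x* differs from x* somewhere in S, so it pays at least m ≥ c(x*) − c(x) extra.

open import Defs
open import Level using (Level)
open import Data.Nat using (ℕ; zero; suc)
open import Data.Bool using (Bool; true; false; T; if_then_else_; _∧_; _xor_)
open import Data.Bool.Properties using (T-irrelevant; T-≡; T-∧) renaming (_≟_ to _≟ᵇ_)
open import Data.Fin using (Fin; zero; suc)
open import Data.Fin.Subset using (Subset)
open import Data.Vec using (Vec; []; _∷_; lookup)
open import Data.Vec.Properties using (≡-dec; []=⇒lookup)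
open import Data.Vec.Functional using (Vector)
open import Data.Product using (∃; _,_)
open import Function using (_∘_; Equivalence)
open import Relation.Nullary using (yes; no; contradiction)
open import Relation.Binary.PropositionalEquality as ≡ using (_≡_; _≢_)
open import Relation.Binary.Bundles using (TotalOrder)
import Algebra.Construct.NaturalChoice.Max as Max
import Algebra.Properties.CommutativeMonoid.Sum as MonoidSum
import Relation.Binary.Reasoning.PartialOrder as PosetReasoning

≢⇒T-xor : ∀ {a b} → a ≢ b → T (a xor b)
≢⇒T-xor {false} {false} a≢b = contradiction ≡.refl a≢b
≢⇒T-xor {false} {true}  _   = _
≢⇒T-xor {true}  {false} _   = _
≢⇒T-xor {true}  {true}  a≢b = contradiction ≡.refl a≢b

mismatch : ∀ {n} → Subset n → Vec Bool n → Vec Bool n → Fin n → Bool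
mismatch S x y e = lookup S e ∧ (lookup x e xor lookup y e)

identifying⇒mismatch : ∀ {n} {X : Vec Bool n → Bool} {S : Subset n} → Identifying X S →
                       ∀ {x y} → T (X x) → T (X y) → x ≢ y → ∃ (T ∘ mismatch S x y)
identifying⇒mismatch identifying x∈X y∈X x≢y with identifying _ _ x∈X y∈X x≢y
... | e , e∈S , xₑ≢yₑ =
  e , Equivalence.from T-∧ (Equivalence.from T-≡ ([]=⇒lookup e∈S) , ≢⇒T-xor xₑ≢yₑ)

module OrderedFieldProperties {c ℓ₁ ℓ₂ : Level} (F : OrderedField c ℓ₁ ℓ₂) where
  open OrderedField F hiding (zero) renaming (_≤_ to infix 4 _≤_)

  totalOrder : TotalOrder c ℓ₁ ℓ₂
  totalOrder = record { isTotalOrder = isTotalOrder }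

  open TotalOrder totalOrder using (poset) renaming (refl to ≤-refl)
  open Max totalOrder using (_⊔_; x≤y⇒x≤y⊔z; x≤y⇒x≤z⊔y)
  open MonoidSum +-commutativeMonoid using (sum; sum-cong-≋; ∑-distrib-+)
  open PosetReasoning poset

  +-monoʳ-≤ : ∀ {a b} d → a ≤ b → d + a ≤ d + b
  +-monoʳ-≤ {a} {b} d a≤b = begin
    d + a ≈⟨ +-comm d a ⟩
    a + d ≤⟨ +-monoˡ-≤ d a≤b ⟩
    b + d ≈⟨ +-comm b d ⟩
    d + b ∎

  x≤x+y : ∀ x {y} → 0# ≤ y → x ≤ x + y
  x≤x+y x {y} 0≤y = begin
    x      ≈⟨ +-identityʳ x ⟨
    x + 0# ≤⟨ +-monoʳ-≤ x 0≤y ⟩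
    x + y  ∎

  x-y≤z⇒x≤y+z : ∀ {x y z} → x - y ≤ z → x ≤ y + z
  x-y≤z⇒x≤y+z {x} {y} {z} x-y≤z = begin
    x             ≈⟨ +-identityʳ x ⟨
    x + 0#        ≈⟨ +-congˡ (-‿inverseˡ y) ⟨
    x + (- y + y) ≈⟨ +-assoc x (- y) y ⟨
    (x - y) + y   ≤⟨ +-monoˡ-≤ y x-y≤z ⟩
    z + y         ≈⟨ +-comm z y ⟩
    y + z         ∎

  ∑≡sum : ∀ {n} (f : Vector Carrier n) → ∑ F f ≡ sum f
  ∑≡sum {zero}  f = ≡.refl
  ∑≡sum {suc n} f = ≡.cong (f zero +_) (∑≡sum (f ∘ suc))

  ∑-nonneg : ∀ {n} (f : Vector Carrier n) → (∀ e → 0# ≤ f e) → 0# ≤ ∑ F f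
  ∑-nonneg {zero}  f 0≤f = ≤-refl
  ∑-nonneg {suc n} f 0≤f = begin
    0#                    ≤⟨ 0≤f zero ⟩
    f zero                ≤⟨ x≤x+y (f zero) (∑-nonneg (f ∘ suc) (0≤f ∘ suc)) ⟩
    f zero + ∑ F (f ∘ suc) ∎

  term≤∑ : ∀ {n} (f : Vector Carrier n) → (∀ e → 0# ≤ f e) → ∀ e → f e ≤ ∑ F f
  term≤∑ f 0≤f zero    = x≤x+y (f zero) (∑-nonneg (f ∘ suc) (0≤f ∘ suc))
  term≤∑ f 0≤f (suc e) = begin
    f (suc e)              ≤⟨ term≤∑ (f ∘ suc) (0≤f ∘ suc) e ⟩
    ∑ F (f ∘ suc)          ≈⟨ +-identityˡ _ ⟨
    0# + ∑ F (f ∘ suc)     ≤⟨ +-monoˡ-≤ _ (0≤f zero) ⟩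
    f zero + ∑ F (f ∘ suc) ∎

  indicator : Carrier → Bool → Carrier
  indicator m b = if b then m else 0#

  indicator-T : ∀ {m b} → T b → indicator m b ≈ m
  indicator-T {b = true} _ = refl

  0≤indicator : ∀ {m} b → 0# ≤ m → 0# ≤ indicator m b
  0≤indicator true  0≤m = 0≤m
  0≤indicator false 0≤m = ≤-refl

  ≤-∑-indicator : ∀ {n m} (b : Fin n → Bool) → 0# ≤ m → ∃ (T ∘ b) → m ≤ ∑ F (indicator m ∘ b)
  ≤-∑-indicator {m = m} b 0≤m (e , be) = begin
    m                      ≈⟨ indicator-T be ⟨
    indicator m (b e)      ≤⟨ term≤∑ (indicator m ∘ b) (λ e′ → 0≤indicator (b e′) 0≤m) e ⟩
    ∑ F (indicator m ∘ b)  ∎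

  T-boundedAbove : ∀ b (g : T b → Carrier) → ∃ λ m → ∀ p → g p ≤ m
  T-boundedAbove false g = 0# , λ ()
  T-boundedAbove true  g = g _ , λ _ → ≤-refl

  boundedAbove : ∀ {n} (P : Vec Bool n → Bool) (f : ∀ y → T (P y) → Carrier) →
                 ∃ λ m → ∀ y p → f y p ≤ m
  boundedAbove {zero} P f with T-boundedAbove (P []) (f [])
  ... | m , f≤m = m , λ { [] → f≤m }
  boundedAbove {suc n} P f
    with boundedAbove (P ∘ (true ∷_)) (f ∘ (true ∷_))
       | boundedAbove (P ∘ (false ∷_)) (f ∘ (false ∷_))
  ... | m₁ , f≤m₁ | m₀ , f≤m₀ = m₁ ⊔ m₀ , λ where
    (true ∷ y)  p → x≤y⇒x≤y⊔z m₀ (f≤m₁ y p)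
    (false ∷ y) p → x≤y⇒x≤z⊔y m₁ (f≤m₀ y p)

  deviationWeights : ∀ {n} → Carrier → Vec Bool n → Fin n → Carrier
  deviationWeights m x* e = if lookup x* e then - m else m

  penalty-term-split : ∀ m s a b →
    let w = if a then - m else m in
    (if s ∧ a then w else 0#) + indicator m (s ∧ (b xor a)) ≈ (if s ∧ b then w else 0#)
  penalty-term-split m false a     b     = +-identityˡ 0#
  penalty-term-split m true  true  true  = +-identityʳ (- m)
  penalty-term-split m true  true  false = -‿inverseˡ m
  penalty-term-split m true  false true  = +-identityˡ m
  penalty-term-split m true  false false = +-identityˡ 0#

  penalty-deviationWeights : ∀ {n} m (S : Subset n) (x* x : Vec Bool n) →
    let w = deviationWeights m x* in
    penalty F S w x* + ∑ F (indicator m ∘ mismatch S x x*) ≈ penalty F S w x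
  penalty-deviationWeights m S x* x = begin-equality
    ∑ F f + ∑ F g             ≡⟨ ≡.cong₂ _+_ (∑≡sum f) (∑≡sum g) ⟩
    sum f + sum g             ≈⟨ ∑-distrib-+ f g ⟨
    sum (λ e → f e + g e)     ≈⟨ sum-cong-≋ split ⟩
    sum h                     ≡⟨ ∑≡sum h ⟨
    ∑ F h                     ∎
    where
    f = λ e → if lookup S e ∧ lookup x* e then deviationWeights m x* e else 0#
    g = indicator m ∘ mismatch S x x*
    h = λ e → if lookup S e ∧ lookup x e then deviationWeights m x* e else 0#
    split : ∀ e → f e + g e ≈ h e
    split e = penalty-term-split m (lookup S e) (lookup x* e) (lookup x e)

  penalty-deviationWeights-≥ : ∀ {n m} (S : Subset n) (x* x : Vec Bool n) → 0# ≤ m →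
    ∃ (T ∘ mismatch S x x*) →
    let w = deviationWeights m x* in penalty F S w x* + m ≤ penalty F S w x
  penalty-deviationWeights-≥ {m = m} S x* x 0≤m mismatched = begin
    penalty F S w x* + m                                   ≤⟨ +-monoʳ-≤ _ (≤-∑-indicator _ 0≤m mismatched) ⟩
    penalty F S w x* + ∑ F (indicator m ∘ mismatch S x x*) ≈⟨ penalty-deviationWeights m S x* x ⟩
    penalty F S w x                                        ∎
    where
    w = deviationWeights m x*

module _ {c ℓ₁ ℓ₂ : Level} (F : OrderedField c ℓ₁ ℓ₂) where
  open OrderedField F hiding (zero) renaming (_≤_ to infix 4 _≤_)
  open OrderedFieldProperties F
  open TotalOrder totalOrder using (poset) renaming (refl to ≤-refl)
  open PosetReasoning poset

  identifying⇒controllingAll : ∀ {n} (X : Vec Bool n → Bool) (S : Subset n) →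
                               Identifying X S → ControllingAll F X S
  identifying⇒controllingAll X S identifying cost x* x*∈X
    with boundedAbove X (λ x x∈X → cost x* x*∈X - cost x x∈X)
  ... | m , gap≤m = deviationWeights m x* , optimal
    where
    π : Vec Bool _ → Carrier
    π = penalty F S (deviationWeights m x*)

    0≤m : 0# ≤ m
    0≤m = begin
      0#                          ≈⟨ -‿inverseʳ (cost x* x*∈X) ⟨
      cost x* x*∈X - cost x* x*∈X ≤⟨ gap≤m x* x*∈X ⟩
      m                           ∎

    optimal : ∀ x x∈X → cost x* x*∈X + π x* ≤ cost x x∈X + π x
    optimal x x∈X with ≡-dec _≟ᵇ_ x x*
    ... | yes ≡.refl rewrite T-irrelevant x∈X x*∈X = ≤-refl
    ... | no x≢x* = begin
      cost x* x*∈X + π x*      ≤⟨ +-monoˡ-≤ (π x*) (x-y≤z⇒x≤y+z (gap≤m x x∈X)) ⟩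
      (cost x x∈X + m) + π x*  ≈⟨ +-assoc (cost x x∈X) m (π x*) ⟩
      cost x x∈X + (m + π x*)  ≈⟨ +-congˡ (+-comm m (π x*)) ⟩
      cost x x∈X + (π x* + m)  ≤⟨ +-monoʳ-≤ (cost x x∈X) (penalty-deviationWeights-≥ S x* x 0≤m
                                    (identifying⇒mismatch identifying x∈X x*∈X x≢x*)) ⟩
      cost x x∈X + π x         ∎

theorem3p5 : ∀ {c ℓ₁ ℓ₂ : Level} (F : OrderedField c ℓ₁ ℓ₂) (n : ℕ)
    (X : Vec Bool n → Bool) → (∃ λ x → T (X x)) →
    (S : Subset n) → Identifying X S → ControllingAll F X S
theorem3p5 F n X _ S = identifying⇒controllingAll F X S
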